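{- Let $n$ be an odd positive integer. Every vertex of the tournament $U_n$ is a king.
   Context: $U_n$ is the tournament on vertex set $\{0,1,\dots,n-1\}$ where, for each pair $i<j$, the edge is directed $i\to j$ if $i+j$ is odd and $j\to i$ if $i+j$ is even. A king is a vertex $v$ such that every other vertex $u$ satisfies $v\to u$ or $v\to w\to u$ for some vertex $w$. -}

module Defs where

open import Data.Nat using (ℕ; _+_; _<_)
open import Data.Nat.Properties using ()
open import Data.Fin using (Fin; toℕ)
open import Data.Product using (Σ; ∃; _×_)
open import Data.Sum using (_⊎_)
open import Relation.Binary.PropositionalEquality using (_≡_)
open import Relation.Nullary using (¬_)

open import Data.Nat.Base using (_%_)

Odd : ℕ → Set
Odd m = m % 2 ≡ 1

Even : ℕ → Set
Even m = m % 2 ≡ 0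

U-edge : (n : ℕ) → Fin n → Fin n → Set
U-edge n u v =
  (toℕ u < toℕ v × Odd (toℕ u + toℕ v)) ⊎
  (toℕ v < toℕ u × Even (toℕ u + toℕ v))

IsKing : {V : Set} → (V → V → Set) → V → Set
IsKing {V} E v = (u : V) → ¬ (u ≡ v) → E v u ⊎ (∃ λ w → E v w × E w u)

{-# OPTIONS --safe #-}
-- Every vertex v beats v + 1, every smaller vertex of its own parity and every larger vertex
-- of the other parity. A larger u of the same parity is then reached through v + 1, a smaller
-- u ≥ 1 of the other parity through u - 1, and u = 0 through v + 1; in this last case v is odd,
-- so v + 1 ≠ n because n is odd.
module Submission where

open import Defs
open import Data.Nat using (ℕ; zero; suc; _+_; _<_; z<s; parity)
open import Data.Nat.Properties using (<-cmp; n<1+n; <-trans; ≤∧≢⇒<)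
open import Data.Fin using (Fin; toℕ; fromℕ<)
open import Data.Fin.Properties using (toℕ<n; toℕ-fromℕ<; toℕ-injective)
open import Data.Parity.Base as ℙ using (Parity; 0ℙ; 1ℙ; _⁻¹)
open import Data.Parity.Properties
  using (_≟_; ⁻¹-involutive; p≢p⁻¹; p+p≡0ℙ; p⁻¹+p≡1ℙ; suc-homo-⁻¹; +-homo-+)
open import Data.Product using (∃-syntax; _×_; _,_)
open import Data.Sum using (_⊎_; inj₁; inj₂)
open import Data.Empty using (⊥-elim)
open import Function using (_∘_)
open import Relation.Binary using (tri<; tri≈; tri>)
open import Relation.Binary.PropositionalEquality
  using (_≡_; _≢_; refl; sym; trans; cong; subst; module ≡-Reasoning)
open import Relation.Nullary using (yes; no)

parity≡0ℙ⇒Even : ∀ m → parity m ≡ 0ℙ → Even m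
parity≡0ℙ⇒Even zero          _  = refl
parity≡0ℙ⇒Even (suc zero)    ()
parity≡0ℙ⇒Even (suc (suc m)) eq = parity≡0ℙ⇒Even m eq

parity≡1ℙ⇒Odd : ∀ m → parity m ≡ 1ℙ → Odd m
parity≡1ℙ⇒Odd zero          ()
parity≡1ℙ⇒Odd (suc zero)    _  = refl
parity≡1ℙ⇒Odd (suc (suc m)) eq = parity≡1ℙ⇒Odd m eq

Odd⇒parity≡1ℙ : ∀ m → Odd m → parity m ≡ 1ℙ
Odd⇒parity≡1ℙ zero          ()
Odd⇒parity≡1ℙ (suc zero)    _   = refl
Odd⇒parity≡1ℙ (suc (suc m)) odd = Odd⇒parity≡1ℙ m odd

parity-suc : ∀ m → parity (suc m) ≡ parity m ⁻¹
parity-suc m = trans (sym (⁻¹-involutive (parity (suc m)))) (cong _⁻¹ (suc-homo-⁻¹ m))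

≢⇒≡⁻¹ : ∀ {p q : Parity} → p ≢ q → p ≡ q ⁻¹
≢⇒≡⁻¹ {0ℙ} {0ℙ} p≢q = ⊥-elim (p≢q refl)
≢⇒≡⁻¹ {0ℙ} {1ℙ} _   = refl
≢⇒≡⁻¹ {1ℙ} {0ℙ} _   = refl
≢⇒≡⁻¹ {1ℙ} {1ℙ} p≢q = ⊥-elim (p≢q refl)

-- U-edge n u v unfolds definitionally to toℕ u beats toℕ v.
infix 4 _beats_
_beats_ : ℕ → ℕ → Set
a beats b = (a < b × Odd (a + b)) ⊎ (b < a × Even (a + b))

beats-larger : ∀ {a b} → a < b → parity a ≡ parity b ⁻¹ → a beats b
beats-larger {a} {b} a<b pa≡pb⁻¹ = inj₁ (a<b , parity≡1ℙ⇒Odd (a + b) (begin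
  parity (a + b)           ≡⟨ +-homo-+ a b ⟩
  parity a ℙ.+ parity b    ≡⟨ cong (ℙ._+ parity b) pa≡pb⁻¹ ⟩
  parity b ⁻¹ ℙ.+ parity b ≡⟨ p⁻¹+p≡1ℙ (parity b) ⟩
  1ℙ                       ∎))
  where open ≡-Reasoning

beats-smaller : ∀ {a b} → b < a → parity a ≡ parity b → a beats b
beats-smaller {a} {b} b<a pa≡pb = inj₂ (b<a , parity≡0ℙ⇒Even (a + b) (begin
  parity (a + b)        ≡⟨ +-homo-+ a b ⟩
  parity a ℙ.+ parity b ≡⟨ cong (ℙ._+ parity b) pa≡pb ⟩
  parity b ℙ.+ parity b ≡⟨ p+p≡0ℙ (parity b) ⟩
  0ℙ                    ∎))
  where open ≡-Reasoning

beats-suc : ∀ a → a beats suc a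
beats-suc a = beats-larger (n<1+n a) (sym (suc-homo-⁻¹ a))

BeatsInTwo : ℕ → ℕ → ℕ → Set
BeatsInTwo n v u = ∃[ w ] w < n × v beats w × w beats u

beatsInTwo-above : ∀ {n v u} → u < n → v < u → parity u ≡ parity v → BeatsInTwo n v u
beatsInTwo-above {n} {v} {u} u<n v<u pu≡pv =
  suc v , <-trans 1+v<u u<n , beats-suc v , beats-larger 1+v<u p[1+v]≡pu⁻¹
  where
  p[1+v]≡pu⁻¹ : parity (suc v) ≡ parity u ⁻¹
  p[1+v]≡pu⁻¹ = trans (parity-suc v) (cong _⁻¹ (sym pu≡pv))

  1+v<u : suc v < u
  1+v<u = ≤∧≢⇒< v<u λ { refl → p≢p⁻¹ (parity u) (trans pu≡pv (sym (suc-homo-⁻¹ v))) }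

beatsInTwo-below : ∀ {n v u} → Odd n → v < n → u < v → parity v ≡ parity u ⁻¹ → BeatsInTwo n v u
beatsInTwo-below {n} {v} {suc u} _ v<n 1+u<v pv≡p[1+u]⁻¹ =
  u , <-trans (n<1+n u) (<-trans 1+u<v v<n) ,
  beats-smaller (<-trans (n<1+n u) 1+u<v) pv≡pu , beats-suc u
  where
  pv≡pu : parity v ≡ parity u
  pv≡pu = trans pv≡p[1+u]⁻¹ (suc-homo-⁻¹ u)
beatsInTwo-below {n} {v} {zero} odd-n v<n _ pv≡1ℙ =
  suc v , 1+v<n , beats-suc v , beats-smaller z<s p[1+v]≡0ℙ
  where
  p[1+v]≡0ℙ : parity (suc v) ≡ 0ℙ
  p[1+v]≡0ℙ = trans (parity-suc v) (cong _⁻¹ pv≡1ℙ)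

  1+v<n : suc v < n
  1+v<n = ≤∧≢⇒< v<n λ { refl → p≢p⁻¹ 0ℙ (trans (sym p[1+v]≡0ℙ) (Odd⇒parity≡1ℙ n odd-n)) }

beats-within-two : ∀ {n v u} → Odd n → v < n → u < n → u ≢ v → v beats u ⊎ BeatsInTwo n v u
beats-within-two {n} {v} {u} odd-n v<n u<n u≢v with parity u ≟ parity v | <-cmp u v
... | _        | tri≈ _ u≡v _ = ⊥-elim (u≢v u≡v)
... | yes same | tri< u<v _ _ = inj₁ (beats-smaller u<v (sym same))
... | yes same | tri> _ _ v<u = inj₂ (beatsInTwo-above u<n v<u same)
... | no diff  | tri> _ _ v<u = inj₁ (beats-larger v<u (≢⇒≡⁻¹ (diff ∘ sym)))
... | no diff  | tri< u<v _ _ = inj₂ (beatsInTwo-below odd-n v<n u<v (≢⇒≡⁻¹ (diff ∘ sym)))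

lemma3p4 : (n : ℕ) → 0 < n → Odd n → (v : Fin n) → IsKing (U-edge n) v
lemma3p4 n _ odd-n v u u≢v with beats-within-two odd-n (toℕ<n v) (toℕ<n u) (u≢v ∘ toℕ-injective)
... | inj₁ v⇒u = inj₁ v⇒u
... | inj₂ (w , w<n , v⇒w , w⇒u) =
  inj₂ (fromℕ< w<n , subst (toℕ v beats_) w≡w′ v⇒w , subst (_beats toℕ u) w≡w′ w⇒u)
  where
  w≡w′ : w ≡ toℕ (fromℕ< w<n)
  w≡w′ = sym (toℕ-fromℕ< w<n)
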